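{- Let $\sigma$ be a complete ordering of $r$ modes. Among all finite sequences of $\textsc{PartialSort}$ calls that transform any list of $r$-coordinates sorted under the simple ordering $(1,2,\ldots,r)$ into a list sorted under $\sigma$, the sequence of calls made by $\textsc{QuesadillaSort}(\cdot,\sigma)$ has minimum length.
   Context: An $r$-coordinate is a tuple $(i_1,\ldots,i_r)$ of integers with $1\le i_m\le n_m$; position $m$ is mode $m$. A complete ordering is a tuple of all $r$ modes in some order (a permutation of $(1,\ldots,r)$). Coordinates are compared lexicographically under an ordering $\sigma$: $i<i'$ if $i_{\sigma_1}<i'_{\sigma_1}$, or $i_{\sigma_1}=i'_{\sigma_1}$ and $i<i'$ under $(\sigma_2,\ldots)$; all tuples are equal under $()$. A list is sorted under $\sigma$ if nondecreasing in this order. For $A$ sorted under a complete ordering $\psi$ and $0\le l<k\le r$, $\textsc{PartialSort}(A,(\psi_1,\ldots,\psi_l),\psi_k)$ returns the coordinates of $A$ rearranged to be sorted under $(\psi_1,\ldots,\psi_l,\psi_k,\psi_{l+1},\ldots,\psi_{k-1},\psi_{k+1},\ldots,\psi_r)$. A sequence of $\textsc{PartialSort}$ calls consists of statements $A\gets\textsc{PartialSort}(A,(\psi_1,\ldots,\psi_l),\psi_k)$ with $k>l\ge0$, where $\psi$ is the current complete ordering of $A$ (initially $(1,\ldots,r)$, and updated after each call to the output ordering above). For a complete ordering $\tau$ and mode $p=\tau_k$, $f(\tau,p)=\{\tau_{k+1},\ldots,\tau_r\}$. $\textsc{QuesadillaSort}(A,\sigma)$ is the procedure (indices 1-based): set $l\gets0$;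 while $l<r$: set $k\gets l$; while $k+1<r$ and $f(\sigma,\sigma_{k+1})\not\subseteq f((1,2,\ldots,r),\sigma_{k+1})$, set $k\gets k+1$; set $l'\gets k+1$; while $k>l$: set $A\gets\textsc{PartialSort}(A,(\sigma_1,\ldots,\sigma_l),\sigma_k)$ and $k\gets k-1$; then set $l\gets l'$. Finally return $A$. -}

module Defs where

open import Data.Nat using (ℕ; zero; suc; _<_; _≤_; _∸_)
open import Data.Fin as Fin using (Fin)
open import Data.Bool using (Bool; true; false; if_then_else_; not)
open import Data.Maybe using (Maybe; just; nothing)
open import Data.List using (List; []; _∷_; _++_; take; drop; length; allFin; reverse; map)
open import Data.List.Relation.Unary.All using (All)
open import Data.List.Relation.Unary.Linked using (Linked)
open import Data.List.Relation.Binary.Permutation.Propositional using (_↭_)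
open import Data.List.Membership.Propositional using (_∈_)
open import Data.Product using (Σ; ∃; ∃-syntax; _×_; _,_)
open import Data.Sum using (_⊎_)
open import Data.Empty using (⊥)
open import Data.Unit using (⊤)
open import Relation.Nullary using (does)
open import Relation.Binary.PropositionalEquality using (_≡_)
import Data.List.Relation.Binary.Subset.DecPropositional as SubDec

-- Modes are 1..r, represented by Fin r (mode m+1 is Fin value m).
-- An r-coordinate: a value i_m for every mode m.
Coord : ℕ → Set
Coord r = Fin r → ℕ

InBounds : ∀ {r} → (Fin r → ℕ) → Coord r → Set
InBounds n i = ∀ m → 1 ≤ i m × i m ≤ n m

Ordering : ℕ → Set
Ordering r = List (Fin r)

simpleOrdering : ∀ r → Ordering r
simpleOrdering r = allFin r

IsCompleteOrdering : ∀ r → Ordering r → Set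
IsCompleteOrdering r τ = τ ↭ simpleOrdering r

LtUnder : ∀ {r} → Ordering r → Coord r → Coord r → Set
LtUnder [] i j = ⊥
LtUnder (m ∷ τ) i j = i m < j m ⊎ (i m ≡ j m × LtUnder τ i j)

EqUnder : ∀ {r} → Ordering r → Coord r → Coord r → Set
EqUnder [] i j = ⊤
EqUnder (m ∷ τ) i j = i m ≡ j m × EqUnder τ i j

LeUnder : ∀ {r} → Ordering r → Coord r → Coord r → Set
LeUnder τ i j = LtUnder τ i j ⊎ EqUnder τ i j

SortedUnder : ∀ {r} → Ordering r → List (Coord r) → Set
SortedUnder τ A = Linked (LeUnder τ) A

-- A call PartialSort(A, (ψ_1..ψ_l), ψ_k) is recorded by its arguments:
-- the prefix tuple and the mode.
Call : ℕ → Set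
Call r = Ordering r × Fin r

-- 1-based access: elemAt k xs = just x_k when 1 ≤ k ≤ length xs.
elemAt : ∀ {A : Set} → ℕ → List A → Maybe A
elemAt zero _ = nothing
elemAt (suc k) [] = nothing
elemAt (suc zero) (x ∷ xs) = just x
elemAt (suc (suc k)) (x ∷ xs) = elemAt (suc k) xs

-- Output ordering of PartialSort with parameters l, k (where ψ_k = p):
-- (ψ_1..ψ_l, ψ_k, ψ_{l+1}..ψ_{k-1}, ψ_{k+1}..ψ_r).
partialSortOrdering : ∀ {r} → Ordering r → ℕ → ℕ → Fin r → Ordering r
partialSortOrdering ψ l k p = take l ψ ++ (p ∷ (drop l (take (k ∸ 1) ψ) ++ drop k ψ))

-- A single valid statement A ← PartialSort(A, pre, p) when the current
-- complete ordering is ψ: pre = (ψ_1..ψ_l), p = ψ_k, 0 ≤ l < k ≤ r;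
-- ψ' is the resulting ordering.
Step : ∀ {r} → Ordering r → Call r → Ordering r → Set
Step ψ (pre , p) ψ' =
  Σ ℕ λ l → Σ ℕ λ k →
    l < k × elemAt k ψ ≡ just p × pre ≡ take l ψ × ψ' ≡ partialSortOrdering ψ l k p

data ValidSeq {r} : Ordering r → List (Call r) → Ordering r → Set where
  done : ∀ {ψ} → ValidSeq ψ [] ψ
  step : ∀ {ψ ψ' ψf c cs} → Step ψ c ψ' → ValidSeq ψ' cs ψf → ValidSeq ψ (c ∷ cs) ψf

-- Execution of a sequence on a list of coordinates: each call returns the
-- coordinates of its input rearranged (a permutation) so as to be sorted
-- under the new ordering.
data Run {r} : Ordering r → List (Call r) → List (Coord r) → List (Coord r) → Set where
  done : ∀ {ψ A} → Run ψ [] A A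
  step : ∀ {ψ ψ' c cs A A' B} → Step ψ c ψ' → A' ↭ A → SortedUnder ψ' A' →
         Run ψ' cs A' B → Run ψ (c ∷ cs) A B

Transforms : ∀ r → Ordering r → List (Call r) → Set
Transforms r σ cs =
  (∃[ ψf ] ValidSeq (simpleOrdering r) cs ψf) ×
  (∀ (n : Fin r → ℕ) (A B : List (Coord r)) → All (InBounds n) A →
     SortedUnder (simpleOrdering r) A → Run (simpleOrdering r) cs A B →
     SortedUnder σ B)

-- f(τ, p): the modes after p in τ.
after : ∀ {r} → Fin r → Ordering r → List (Fin r)
after p [] = []
after p (x ∷ xs) = if does (x Fin.≟ p) then xs else after p xs

notSubsetTest : ∀ r → Ordering r → Fin r → Bool
notSubsetTest r σ p =
  not (does (SubDec._⊆?_ Fin._≟_ (after p σ) (after p (simpleOrdering r))))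

-- Given the remaining suffix (σ_{l+1}, ..., σ_r) of σ, the inner scan
-- "k ← l; while k+1 < r and f(σ,σ_{k+1}) ⊈ f(id,σ_{k+1}): k ← k+1"
-- ends with k = l + scanLen (σ_{l+1}, ..., σ_r).  (σ_{k+1} is the
-- (k-l+1)-th entry of the suffix, and k+1 < r iff it is not the last one.)
scanLen : ∀ r → Ordering r → List (Fin r) → ℕ
scanLen r σ [] = 0
scanLen r σ (x ∷ []) = 0
scanLen r σ (x ∷ y ∷ ys) =
  if notSubsetTest r σ x then suc (scanLen r σ (y ∷ ys)) else 0

-- Outer loop.  pre = (σ_1..σ_l), rest = (σ_{l+1}..σ_r).  With j = scanLen,
-- k = l + j, l' = k + 1, the calls made are PartialSort(A, pre, σ_k),
-- PartialSort(A, pre, σ_{k-1}), ..., PartialSort(A, pre, σ_{l+1}), i.e.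
-- the modes reverse (take j rest); then l ← l'.  The fuel argument
-- (initially r) is never exhausted since l strictly increases.
quesadillaLoop : ∀ r → Ordering r → ℕ → Ordering r → List (Fin r) → List (Call r)
quesadillaLoop r σ zero pre rest = []
quesadillaLoop r σ (suc fuel) pre [] = []
quesadillaLoop r σ (suc fuel) pre (x ∷ xs) =
  map (λ p → (pre , p)) (reverse (take j (x ∷ xs))) ++
  quesadillaLoop r σ fuel (pre ++ take (suc j) (x ∷ xs)) (drop (suc j) (x ∷ xs))
  where
  j = scanLen r σ (x ∷ xs)

quesadillaCalls : ∀ r → Ordering r → List (Call r)
quesadillaCalls r σ = quesadillaLoop r σ r [] σ

-- Call a mode inverted in an ordering when it precedes some smaller mode.  A call
-- PartialSort(A, (ψ_1, ..., ψ_l), ψ_k) only moves ψ_k forward past ψ_{l+1}, ..., ψ_{k-1}, so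
-- a mode other than ψ_k precedes afterwards only modes it preceded before: each call creates
-- at most one new inverted mode, and (1, ..., r) has none.  A sequence transforming every list
-- sorted under (1, ..., r) into one sorted under σ must end in an ordering that puts every
-- pair of modes x, y in the same relative order as σ, since otherwise the two coordinates
-- that are 1 everywhere except for a 2 at x, respectively at y, would be sorted in opposite
-- ways.  So that final ordering has at least as many inverted modes as σ, and the sequence
-- has at least that many calls.  QuesadillaSort makes one call per mode x with
-- f(σ, x) ⊈ f((1, ..., r), x), and each such x is inverted in σ.  That its calls really
-- produce σ is checked block by block, keeping the not yet placed modes in increasing order.

module Submission where

open import Defs
open import Data.Nat as ℕ using (ℕ; zero; suc; _+_; _≤_; _<_; z≤n; s≤s)
import Data.Nat.Properties as ℕ
open import Data.Fin as Fin using (Fin; _≟_)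
import Data.Fin.Properties as Fin
open import Data.Bool using (true; false; if_then_else_; not)
open import Data.Maybe using (just)
open import Data.List
  using (List; []; _∷_; _++_; [_]; take; drop; length; allFin; reverse; map; filter)
open import Data.List.Properties
  using ( ++-assoc; ++-cancelˡ; ∷-injective; take++drop≡id; take-take; length-++; length-map
        ; length-reverse; length-tabulate; filter-++; filter-all; filter-none; unfold-reverse
        ; reverse-involutive)
open import Data.List.Relation.Unary.All as All using (All; []; _∷_)
import Data.List.Relation.Unary.All.Properties as Allₚ
open import Data.List.Relation.Unary.Any as Any using (here; there)
open import Data.List.Relation.Unary.Linked using ([-]; _∷_)
open import Data.List.Relation.Unary.AllPairs as AllPairs using (AllPairs; []; _∷_)
import Data.List.Relation.Unary.AllPairs.Properties as AllPairsₚ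
open import Data.List.Relation.Unary.Unique.Propositional using (Unique)
open import Data.List.Relation.Unary.Unique.Propositional.Properties using (allFin⁺)
open import Data.List.Relation.Binary.Permutation.Propositional
  using (_↭_; ↭-refl; ↭-sym; ↭-trans; ↭-swap; ↭⇒↭ₛ)
open import Data.List.Relation.Binary.Permutation.Propositional.Properties
  using (shift; ++⁺ˡ; ++⁺ʳ; ∈-resp-↭; ↭-length; filter-↭; drop-∷; ↭-empty-inv; ↭-reverse)
import Data.List.Relation.Binary.Permutation.Setoid.Properties as PermutationSetoidₚ
open import Data.List.Relation.Binary.Sublist.Propositional using (⊆-refl)
open import Data.List.Relation.Binary.Sublist.Propositional.Properties
  using (filter⁺; length-mono-≤)
open import Data.List.Membership.Propositional using (_∈_; _∉_; find)
open import Data.List.Membership.Propositional.Properties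
  using (∈-++⁺ˡ; ∈-++⁺ʳ; ∈-++⁻; ∈-allFin; ∈-∃++)
open import Data.Product using (∃; ∃₂; ∃-syntax; _×_; _,_; proj₁; proj₂)
open import Data.Sum as Sum using (_⊎_; inj₁; inj₂)
open import Data.Empty using (⊥; ⊥-elim)
open import Function using (id; _∘_; _∘′_)
open import Relation.Nullary using (¬_; Dec; yes; no; does)
open import Relation.Nullary.Decidable as Dec using (_×-dec_)
open import Relation.Unary using (Decidable)
open import Relation.Binary using (DecidableEquality; tri<; tri≈; tri>)
open import Relation.Binary.PropositionalEquality
  using (_≡_; _≢_; refl; sym; trans; cong; cong₂; subst; subst₂; setoid; module ≡-Reasoning)

module _ {A : Set} where

  elemAt-split : ∀ k (xs : List A) {x} → elemAt (suc k) xs ≡ just x →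
                 xs ≡ take k xs ++ x ∷ drop (suc k) xs
  elemAt-split k       []       ()
  elemAt-split zero    (y ∷ xs) refl = refl
  elemAt-split (suc k) (y ∷ xs) e    = cong (y ∷_) (elemAt-split k xs e)

  elemAt-length-++ : ∀ (xs : List A) x ys → elemAt (suc (length xs)) (xs ++ x ∷ ys) ≡ just x
  elemAt-length-++ []       x ys = refl
  elemAt-length-++ (y ∷ xs) x ys = elemAt-length-++ xs x ys

  take-length-++ : ∀ (xs ys : List A) → take (length xs) (xs ++ ys) ≡ xs
  take-length-++ []       ys = refl
  take-length-++ (x ∷ xs) ys = cong (x ∷_) (take-length-++ xs ys)

  take-suc-length-++ : ∀ (xs : List A) x ys → take (suc (length xs)) (xs ++ x ∷ ys) ≡ xs ++ [ x ]
  take-suc-length-++ []       x ys = refl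
  take-suc-length-++ (y ∷ xs) x ys = cong (y ∷_) (take-suc-length-++ xs x ys)

  drop-suc-length-++ : ∀ (xs : List A) x ys → drop (suc (length xs)) (xs ++ x ∷ ys) ≡ ys
  drop-suc-length-++ []       x ys = refl
  drop-suc-length-++ (y ∷ xs) x ys = drop-suc-length-++ xs x ys

  ++-∷ʳ-assoc : ∀ (xs ys : List A) y zs → (xs ++ ys ++ [ y ]) ++ zs ≡ xs ++ ys ++ y ∷ zs
  ++-∷ʳ-assoc xs ys y zs = trans (++-assoc xs (ys ++ [ y ]) zs) (cong (xs ++_) (++-assoc ys [ y ] zs))

  ++-cancel-∉ : ∀ xs₁ xs₂ {x} {ys₁ ys₂ : List A} → x ∉ xs₁ → x ∉ xs₂ →
                xs₁ ++ x ∷ ys₁ ≡ xs₂ ++ x ∷ ys₂ → xs₁ ≡ xs₂ × ys₁ ≡ ys₂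
  ++-cancel-∉ []        []        _   _   e = refl , proj₂ (∷-injective e)
  ++-cancel-∉ []        (y ∷ xs₂) _   x∉₂ e = ⊥-elim (x∉₂ (here (proj₁ (∷-injective e))))
  ++-cancel-∉ (y ∷ xs₁) []        x∉₁ _   e = ⊥-elim (x∉₁ (here (sym (proj₁ (∷-injective e)))))
  ++-cancel-∉ (y ∷ xs₁) (z ∷ xs₂) x∉₁ x∉₂ e
    with refl , e′   ← ∷-injective e
    with refl , refl ← ++-cancel-∉ xs₁ xs₂ (x∉₁ ∘′ there) (x∉₂ ∘′ there) e′ = refl , refl

  Unique-resp-↭ : ∀ {xs ys : List A} → xs ↭ ys → Unique xs → Unique ys
  Unique-resp-↭ xs↭ys = PermutationSetoidₚ.Unique-resp-↭ (setoid A) (↭⇒↭ₛ xs↭ys)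

  Unique-++⁻ʳ : ∀ xs {ys : List A} → Unique (xs ++ ys) → Unique ys
  Unique-++⁻ʳ []       u       = u
  Unique-++⁻ʳ (x ∷ xs) (_ ∷ u) = Unique-++⁻ʳ xs u

  Unique-middle-∉ : ∀ xs {x} {ys : List A} → Unique (xs ++ x ∷ ys) → x ∉ xs
  Unique-middle-∉ (y ∷ xs) (y∉ ∷ _) (here refl) = All.lookup y∉ (∈-++⁺ʳ xs (here refl)) refl
  Unique-middle-∉ (y ∷ xs) (_  ∷ u) (there x∈)  = Unique-middle-∉ xs u x∈

  AllPairs-delete : ∀ {R : A → A → Set} xs {y ys} → AllPairs R (xs ++ y ∷ ys) → AllPairs R (xs ++ ys)
  AllPairs-delete []       (_ ∷ ps)  = ps
  AllPairs-delete (x ∷ xs) (x~ ∷ ps) =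
    Allₚ.++⁺ (Allₚ.++⁻ˡ xs x~) (All.tail (Allₚ.++⁻ʳ xs x~)) ∷ AllPairs-delete xs ps

  count : ∀ {P : A → Set} → Decidable P → List A → ℕ
  count P? xs = length (filter P? xs)

  count-mono : ∀ {P Q : A → Set} (P? : Decidable P) (Q? : Decidable Q) →
               (∀ {x} → P x → Q x) → ∀ xs → count P? xs ≤ count Q? xs
  count-mono P? Q? P⇒Q xs = length-mono-≤ (filter⁺ P? Q? (λ { refl → P⇒Q }) (⊆-refl {x = xs}))

  count-∷ : ∀ {P : A → Set} (P? : Decidable P) x xs → count P? xs ≤ count P? (x ∷ xs)
  count-∷ P? x xs with does (P? x)
  ... | true  = ℕ.n≤1+n _
  ... | false = ℕ.≤-refl

  count-⊎ : ∀ {P Q R : A → Set} (P? : Decidable P) (Q? : Decidable Q) (R? : Decidable R) →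
            (∀ {x} → P x → Q x ⊎ R x) → ∀ xs → count P? xs ≤ count Q? xs + count R? xs
  count-⊎ P? Q? R? split []       = z≤n
  count-⊎ P? Q? R? split (x ∷ xs) with ih ← count-⊎ P? Q? R? split xs | P? x
  ... | no _ = ℕ.≤-trans ih (ℕ.+-mono-≤ (count-∷ Q? x xs) (count-∷ R? x xs))
  ... | yes px with Q? x
  ...   | yes _ = s≤s (ℕ.≤-trans ih (ℕ.+-monoʳ-≤ _ (count-∷ R? x xs)))
  ...   | no ¬qx with R? x
  ...     | yes _  = ℕ.≤-trans (s≤s ih) (ℕ.≤-reflexive (sym (ℕ.+-suc _ _)))
  ...     | no ¬rx = ⊥-elim (Sum.[ ¬qx , ¬rx ] (split px))

  count-++ : ∀ {P : A → Set} (P? : Decidable P) xs ys →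
             count P? (xs ++ ys) ≡ count P? xs + count P? ys
  count-++ P? xs ys = trans (cong length (filter-++ P? xs ys)) (length-++ (filter P? xs))

  count-↭ : ∀ {P : A → Set} (P? : Decidable P) {xs ys} → xs ↭ ys → count P? xs ≡ count P? ys
  count-↭ P? xs↭ys = ↭-length (filter-↭ P? xs↭ys)

  count-all : ∀ {P : A → Set} (P? : Decidable P) {xs} → All P xs → count P? xs ≡ length xs
  count-all P? all = cong length (filter-all P? all)

  count-none : ∀ {P : A → Set} (P? : Decidable P) {xs} → All (¬_ ∘ P) xs → count P? xs ≡ 0
  count-none P? none = cong length (filter-none P? none)

  count-≡-≤1 : (_≟_ : DecidableEquality A) → ∀ {p xs} → Unique xs → count (_≟ p) xs ≤ 1
  count-≡-≤1 _≟_ {p} {[]}     _        = z≤n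
  count-≡-≤1 _≟_ {p} {x ∷ xs} (x∉ ∷ u) with x ≟ p
  ... | yes refl = s≤s (ℕ.≤-reflexive (count-none (_≟ x) (All.map (_∘ sym) x∉)))
  ... | no _     = count-≡-≤1 _≟_ u

not-does≡true⇒¬ : ∀ {P : Set} (P? : Dec P) → not (does P?) ≡ true → ¬ P
not-does≡true⇒¬ (no ¬p) _ = ¬p

not-does≡false⇒ : ∀ {P : Set} (P? : Dec P) → not (does P?) ≡ false → P
not-does≡false⇒ (yes p) _ = p

module _ {r : ℕ} where

  open import Data.List.Membership.DecPropositional (_≟_ {r}) using (_∈?_)
  open import Data.List.Relation.Binary.Subset.DecPropositional (_≟_ {r}) using (_⊆_; _⊆?_)

  Hoist : Ordering r → Fin r → Ordering r → Ordering r → Set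
  Hoist a p ψ ψ′ = ∃₂ λ m z → ψ ≡ a ++ m ++ p ∷ z × ψ′ ≡ a ++ p ∷ m ++ z

  Step⇒Hoist : ∀ {ψ a ψ′ : Ordering r} {p} → Step ψ (a , p) ψ′ → Hoist a p ψ ψ′
  Step⇒Hoist {ψ} {p = p} (l , suc k , s≤s l≤k , ψₖ≡p , refl , refl) =
    drop l (take k ψ) , drop (suc k) ψ , ψ≡ , refl
    where
    open ≡-Reasoning
    take-k : take k ψ ≡ take l ψ ++ drop l (take k ψ)
    take-k = begin
      take k ψ                               ≡⟨ take++drop≡id l (take k ψ) ⟨
      take l (take k ψ) ++ drop l (take k ψ) ≡⟨ cong (_++ drop l (take k ψ)) (take-take l k ψ) ⟩
      take (l ℕ.⊓ k) ψ ++ drop l (take k ψ)  ≡⟨ cong (λ n → take n ψ ++ drop l (take k ψ))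
                                                      (ℕ.m≤n⇒m⊓n≡m l≤k) ⟩
      take l ψ ++ drop l (take k ψ)          ∎
    ψ≡ : ψ ≡ take l ψ ++ drop l (take k ψ) ++ p ∷ drop (suc k) ψ
    ψ≡ = begin
      ψ                                                     ≡⟨ elemAt-split k ψ ψₖ≡p ⟩
      take k ψ ++ p ∷ drop (suc k) ψ                        ≡⟨ cong (_++ p ∷ _) take-k ⟩
      (take l ψ ++ drop l (take k ψ)) ++ p ∷ drop (suc k) ψ ≡⟨ ++-assoc (take l ψ) _ _ ⟩
      take l ψ ++ drop l (take k ψ) ++ p ∷ drop (suc k) ψ   ∎

  Step-∷ : ∀ {ψ a ψ′ : Ordering r} {p} x → Step ψ (a , p) ψ′ → Step (x ∷ ψ) (x ∷ a , p) (x ∷ ψ′)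
  Step-∷ x (l , suc k , l<k , ψₖ≡p , refl , refl) =
    suc l , suc (suc k) , s≤s l<k , ψₖ≡p , refl , refl

  Step-hoist : ∀ a m p z → Step (a ++ m ++ p ∷ z) (a , p) (a ++ p ∷ m ++ z)
  Step-hoist []      m p z =
    0 , suc (length m) , s≤s z≤n , elemAt-length-++ m p z , refl ,
    cong₂ (λ u v → p ∷ u ++ v) (sym (take-length-++ m (p ∷ z))) (sym (drop-suc-length-++ m p z))
  Step-hoist (x ∷ a) m p z = Step-∷ x (Step-hoist a m p z)

  Step-↭ : ∀ {ψ ψ′ : Ordering r} {c} → Step ψ c ψ′ → ψ′ ↭ ψ
  Step-↭ {c = a , p} st with m , z , refl , refl ← Step⇒Hoist st = ++⁺ˡ a (↭-sym (shift p m z))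

  Step-functional : ∀ {ψ ψ₁ ψ₂ : Ordering r} {c} → Unique ψ → Step ψ c ψ₁ → Step ψ c ψ₂ → ψ₁ ≡ ψ₂
  Step-functional {c = a , p} u st₁ st₂
    with m₁ , z₁ , refl , refl ← Step⇒Hoist st₁
       | m₂ , z₂ , ψ≡   , refl ← Step⇒Hoist st₂
    with refl , refl ← ++-cancel-∉ m₁ m₂ (Unique-middle-∉ m₁ (Unique-++⁻ʳ a u))
                         (Unique-middle-∉ m₂ (Unique-++⁻ʳ a (subst Unique ψ≡ u)))
                         (++-cancelˡ a _ _ ψ≡)
    = refl

  ValidSeq-↭ : ∀ {ψ ψf : Ordering r} {cs} → ValidSeq ψ cs ψf → ψf ↭ ψ
  ValidSeq-↭ done         = ↭-refl
  ValidSeq-↭ (step st vs) = ↭-trans (ValidSeq-↭ vs) (Step-↭ st)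

  ValidSeq-++ : ∀ {ψ ψ′ ψf : Ordering r} {cs ds} →
                ValidSeq ψ cs ψ′ → ValidSeq ψ′ ds ψf → ValidSeq ψ (cs ++ ds) ψf
  ValidSeq-++ done         ws = ws
  ValidSeq-++ (step st vs) ws = step st (ValidSeq-++ vs ws)

  ValidSeq-Run-sorted : ∀ {ψ σ : Ordering r} {cs A B} → Unique ψ → ValidSeq ψ cs σ →
                        SortedUnder ψ A → Run ψ cs A B → SortedUnder σ B
  ValidSeq-Run-sorted u done         sA done                 = sA
  ValidSeq-Run-sorted u (step st vs) _  (step st′ _ sA′ run) =
    ValidSeq-Run-sorted (Unique-resp-↭ (↭-sym (Step-↭ st′)) u)
      (subst (λ ψ → ValidSeq ψ _ _) (Step-functional u st st′) vs) sA′ run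

  data Before (x y : Fin r) : Ordering r → Set where
    here  : ∀ {zs} → y ∈ zs → Before x y (x ∷ zs)
    there : ∀ {z zs} → z ≢ x → z ≢ y → Before x y zs → Before x y (z ∷ zs)

  before? : ∀ x y ψ → Dec (Before x y ψ)
  before? x y []       = no λ ()
  before? x y (z ∷ zs) with z ≟ x | z ≟ y
  ... | yes refl | _        =
    Dec.map′ here (λ { (here y∈) → y∈ ; (there x≢x _ _) → ⊥-elim (x≢x refl) }) (y ∈? zs)
  ... | no z≢x   | yes refl = no λ { (here _) → z≢x refl ; (there _ y≢y _) → y≢y refl }
  ... | no z≢x   | no z≢y   =
    Dec.map′ (there z≢x z≢y) (λ { (here _) → ⊥-elim (z≢x refl) ; (there _ _ b) → b }) (before? x y zs)

  Before-total : ∀ {x y : Fin r} {ψ} → x ∈ ψ → y ∈ ψ → x ≢ y → Before x y ψ ⊎ Before y x ψ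
  Before-total {x} {y} {z ∷ zs} x∈ y∈ x≢y with z ≟ x | z ≟ y
  ... | yes refl | _        = inj₁ (here (Any.tail (x≢y ∘ sym) y∈))
  ... | no z≢x   | yes refl = inj₂ (here (Any.tail x≢y x∈))
  ... | no z≢x   | no z≢y   = Sum.map (there z≢x z≢y) (there z≢y z≢x)
    (Before-total (Any.tail (z≢x ∘ sym) x∈) (Any.tail (z≢y ∘ sym) y∈) x≢y)

  Before-irrefl : ∀ {x : Fin r} {ψ} → Unique ψ → ¬ Before x x ψ
  Before-irrefl (x∉ ∷ _) (here x∈)     = All.lookup x∉ x∈ refl
  Before-irrefl (_  ∷ u) (there _ _ b) = Before-irrefl u b

  private
    ∈-delete : ∀ {y w : Fin r} a {b} → y ≢ w → y ∈ a ++ w ∷ b → y ∈ a ++ b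
    ∈-delete a y≢w y∈ with ∈-++⁻ a y∈
    ... | inj₁ y∈a         = ∈-++⁺ˡ y∈a
    ... | inj₂ (here y≡w)  = ⊥-elim (y≢w y≡w)
    ... | inj₂ (there y∈b) = ∈-++⁺ʳ a y∈b

    ∈-insert : ∀ {y : Fin r} w a {b} → y ∈ a ++ b → y ∈ a ++ w ∷ b
    ∈-insert w a y∈ with ∈-++⁻ a y∈
    ... | inj₁ y∈a = ∈-++⁺ˡ y∈a
    ... | inj₂ y∈b = ∈-++⁺ʳ a (there y∈b)

  Before-delete : ∀ {x y w : Fin r} a {b} → w ≢ x → w ≢ y →
                  Before x y (a ++ w ∷ b) → Before x y (a ++ b)
  Before-delete []      w≢x w≢y (here _)          = ⊥-elim (w≢x refl)
  Before-delete []      w≢x w≢y (there _ _ b)     = b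
  Before-delete (z ∷ a) w≢x w≢y (here y∈)         = here (∈-delete a (w≢y ∘ sym) y∈)
  Before-delete (z ∷ a) w≢x w≢y (there z≢x z≢y b) = there z≢x z≢y (Before-delete a w≢x w≢y b)

  Before-insert : ∀ {x y w : Fin r} a {b} → w ≢ x → w ≢ y →
                  Before x y (a ++ b) → Before x y (a ++ w ∷ b)
  Before-insert []      w≢x w≢y b                 = there w≢x w≢y b
  Before-insert (z ∷ a) w≢x w≢y (here y∈)         = here (∈-insert _ a y∈)
  Before-insert (z ∷ a) w≢x w≢y (there z≢x z≢y b) = there z≢x z≢y (Before-insert a w≢x w≢y b)

  Before-move : ∀ {x y : Fin r} a {b c} → x ≢ y → y ∈ c →
                Before x y (a ++ y ∷ b) → Before x y (a ++ c)
  Before-move []      x≢y y∈ (here _)          = ⊥-elim (x≢y refl)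
  Before-move []      x≢y y∈ (there _ y≢y _)   = ⊥-elim (y≢y refl)
  Before-move (z ∷ a) x≢y y∈ (here _)          = here (∈-++⁺ʳ a y∈)
  Before-move (z ∷ a) x≢y y∈ (there z≢x z≢y b) = there z≢x z≢y (Before-move a x≢y y∈ b)

  Step-Before : ∀ {ψ a ψ′ : Ordering r} {p x y} → Step ψ (a , p) ψ′ → x ≢ p →
                Before x y ψ′ → Before x y ψ
  Step-Before {a = a} {p = p} {x} {y} st x≢p b with m , z , refl , refl ← Step⇒Hoist st | y ≟ p
  ... | yes refl = Before-move a x≢p (∈-++⁺ʳ m (here refl)) b
  ... | no y≢p   =
    subst (Before x y) (++-assoc a m (p ∷ z))
      (Before-insert (a ++ m) (x≢p ∘ sym) (y≢p ∘ sym)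
        (subst (Before x y) (sym (++-assoc a m z)) (Before-delete a (x≢p ∘ sym) (y≢p ∘ sym) b)))

  Ascending : Ordering r → Set
  Ascending = AllPairs Fin._<_

  Ascending-allFin : Ascending (allFin r)
  Ascending-allFin = AllPairsₚ.tabulate⁺-< id

  Ascending-Before⇒< : ∀ {x y : Fin r} {ψ} → Ascending ψ → Before x y ψ → x Fin.< y
  Ascending-Before⇒< (x< ∷ _)  (here y∈)     = All.lookup x< y∈
  Ascending-Before⇒< (_  ∷ as) (there _ _ b) = Ascending-Before⇒< as b

  Ascending-↭-head : ∀ {τ w : Ordering r} {g} → Ascending τ → τ ↭ g ∷ w → All (g Fin.<_) w →
                     ∃[ τ′ ] τ ≡ g ∷ τ′
  Ascending-↭-head {[]} _ τ↭ _ with () ← ∈-resp-↭ (↭-sym τ↭) (here refl)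
  Ascending-↭-head {h ∷ τ} {g = g} (h< ∷ _) τ↭ g< with h ≟ g
  ... | yes refl = τ , refl
  ... | no h≢g with ∈-resp-↭ (↭-sym τ↭) (here refl) | ∈-resp-↭ τ↭ (here refl)
  ...   | here g≡h | _        = ⊥-elim (h≢g (sym g≡h))
  ...   | there _  | here h≡g = ⊥-elim (h≢g h≡g)
  ...   | there g∈ | there h∈ = ⊥-elim (ℕ.<-asym (All.lookup h< g∈) (All.lookup g< h∈))

  ∈-after⁻ : ∀ {x y : Fin r} ψ → y ∈ after x ψ → y ∈ ψ
  ∈-after⁻ {x} (z ∷ zs) y∈ with z ≟ x
  ... | yes _ = there y∈
  ... | no  _ = there (∈-after⁻ zs y∈)

  after-++-∷ : ∀ (a : Ordering r) {g} b → g ∉ a → after g (a ++ g ∷ b) ≡ b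
  after-++-∷ []      {g} b g∉ with g ≟ g
  ... | yes _  = refl
  ... | no g≢g = ⊥-elim (g≢g refl)
  after-++-∷ (z ∷ a) {g} b g∉ with z ≟ g
  ... | yes refl = ⊥-elim (g∉ (here refl))
  ... | no _     = after-++-∷ a b (g∉ ∘ there)

  ∈-after⇒Before : ∀ {x y : Fin r} {ψ} → Unique ψ → y ∈ after x ψ → Before x y ψ
  ∈-after⇒Before {x} {ψ = z ∷ zs} (z∉ ∷ u) y∈ with z ≟ x
  ... | yes refl = here y∈
  ... | no z≢x   =
    there z≢x (λ { refl → All.lookup z∉ (∈-after⁻ zs y∈) refl }) (∈-after⇒Before u y∈)

  Ascending-∈-after⇒< : ∀ {x y : Fin r} {ψ} → Ascending ψ → y ∈ after x ψ → x Fin.< y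
  Ascending-∈-after⇒< {x} {ψ = z ∷ zs} (z< ∷ as) y∈ with z ≟ x
  ... | yes refl = All.lookup z< y∈
  ... | no _     = Ascending-∈-after⇒< as y∈

  Ascending-<⇒∈-after : ∀ {x y : Fin r} {ψ} → Ascending ψ → x ∈ ψ → y ∈ ψ → x Fin.< y →
                        y ∈ after x ψ
  Ascending-<⇒∈-after {x} {y} {z ∷ zs} (z< ∷ as) x∈ y∈ x<y with z ≟ x
  ... | yes refl = Any.tail (λ { refl → ℕ.<-irrefl refl x<y }) y∈
  ... | no z≢x with x∈ | y∈
  ...   | here refl | _         = ⊥-elim (z≢x refl)
  ...   | there _   | here refl = ⊥-elim (ℕ.<-asym x<y (All.lookup z< (Any.tail (z≢x ∘ sym) x∈)))
  ...   | there x∈′ | there y∈′ = Ascending-<⇒∈-after as x∈′ y∈′ x<y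

  Inverted : Ordering r → Fin r → Set
  Inverted ψ x = ∃ λ y → y Fin.< x × Before x y ψ

  inverted? : ∀ ψ → Decidable (Inverted ψ)
  inverted? ψ x = Fin.any? λ y → y Fin.<? x ×-dec before? x y ψ

  Ascending⇒¬Inverted : ∀ {ψ} {x : Fin r} → Ascending ψ → ¬ Inverted ψ x
  Ascending⇒¬Inverted as (y , y<x , b) = ℕ.<-asym y<x (Ascending-Before⇒< as b)

  #inverted : Ordering r → ℕ
  #inverted ψ = count (inverted? ψ) (allFin r)

  #inverted-allFin : #inverted (allFin r) ≡ 0
  #inverted-allFin =
    count-none (inverted? (allFin r)) {allFin r} (All.tabulate λ _ → Ascending⇒¬Inverted Ascending-allFin)

  Step-Inverted : ∀ {ψ a ψ′ : Ordering r} {p x} → Step ψ (a , p) ψ′ →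
                  Inverted ψ′ x → Inverted ψ x ⊎ x ≡ p
  Step-Inverted {p = p} {x} st (y , y<x , b) with x ≟ p
  ... | yes x≡p = inj₂ x≡p
  ... | no x≢p  = inj₁ (y , y<x , Step-Before st x≢p b)

  #inverted-Step : ∀ {ψ a ψ′ : Ordering r} {p} → Step ψ (a , p) ψ′ → #inverted ψ′ ≤ suc (#inverted ψ)
  #inverted-Step {ψ} {ψ′ = ψ′} {p} st = begin
    #inverted ψ′                          ≤⟨ count-⊎ (inverted? ψ′) (inverted? ψ) (_≟ p)
                                                     (Step-Inverted st) (allFin r) ⟩
    #inverted ψ + count (_≟ p) (allFin r) ≤⟨ ℕ.+-monoʳ-≤ (#inverted ψ) (count-≡-≤1 _≟_ (allFin⁺ r)) ⟩
    #inverted ψ + 1                       ≡⟨ ℕ.+-comm (#inverted ψ) 1 ⟩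
    suc (#inverted ψ)                     ∎
    where open ℕ.≤-Reasoning

  #inverted-ValidSeq : ∀ {ψ ψf : Ordering r} {cs} → ValidSeq ψ cs ψf →
                       #inverted ψf ≤ length cs + #inverted ψ
  #inverted-ValidSeq done = ℕ.≤-refl
  #inverted-ValidSeq {ψ} {ψf} {(a , p) ∷ cs} (step {ψ' = ψ′} st vs) = begin
    #inverted ψf                  ≤⟨ #inverted-ValidSeq vs ⟩
    length cs + #inverted ψ′      ≤⟨ ℕ.+-monoʳ-≤ (length cs) (#inverted-Step st) ⟩
    length cs + suc (#inverted ψ) ≡⟨ ℕ.+-suc (length cs) (#inverted ψ) ⟩
    suc (length cs + #inverted ψ) ∎
    where open ℕ.≤-Reasoning

  Before⇒¬LeUnder : ∀ {x y : Fin r} {ψ} {u v : Coord r} → Before x y ψ →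
                    (∀ {z} → z ≢ x → z ≢ y → u z ≡ v z) → u x < v x → ¬ LeUnder ψ v u
  Before⇒¬LeUnder (here _) _ ux<vx (inj₁ (inj₁ vx<ux))      = ℕ.<-asym ux<vx vx<ux
  Before⇒¬LeUnder (here _) _ ux<vx (inj₁ (inj₂ (vx≡ux , _))) = ℕ.<-irrefl (sym vx≡ux) ux<vx
  Before⇒¬LeUnder (here _) _ ux<vx (inj₂ (vx≡ux , _))        = ℕ.<-irrefl (sym vx≡ux) ux<vx
  Before⇒¬LeUnder (there z≢x z≢y b) u≡v _ (inj₁ (inj₁ vz<uz)) =
    ℕ.<-irrefl (sym (u≡v z≢x z≢y)) vz<uz
  Before⇒¬LeUnder (there _ _ b) u≡v ux<vx (inj₁ (inj₂ (_ , v<u))) =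
    Before⇒¬LeUnder b u≡v ux<vx (inj₁ v<u)
  Before⇒¬LeUnder (there _ _ b) u≡v ux<vx (inj₂ (_ , v≡u)) =
    Before⇒¬LeUnder b u≡v ux<vx (inj₂ v≡u)

  LeUnder-total : ∀ ψ (u v : Coord r) → LeUnder ψ u v ⊎ LeUnder ψ v u
  LeUnder-total []      u v = inj₁ (inj₂ _)
  LeUnder-total (m ∷ ψ) u v with ℕ.<-cmp (u m) (v m)
  ... | tri< um<vm _ _ = inj₁ (inj₁ (inj₁ um<vm))
  ... | tri> _ _ vm<um = inj₂ (inj₁ (inj₁ vm<um))
  ... | tri≈ _ um≡vm _ with LeUnder-total ψ u v
  ...   | inj₁ (inj₁ u<v) = inj₁ (inj₁ (inj₂ (um≡vm , u<v)))
  ...   | inj₁ (inj₂ u≡v) = inj₁ (inj₂ (um≡vm , u≡v))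
  ...   | inj₂ (inj₁ v<u) = inj₂ (inj₁ (inj₂ (sym um≡vm , v<u)))
  ...   | inj₂ (inj₂ v≡u) = inj₂ (inj₂ (sym um≡vm , v≡u))

  data TwoList (u v : Coord r) : List (Coord r) → Set where
    uv : TwoList u v (u ∷ v ∷ [])
    vu : TwoList u v (v ∷ u ∷ [])

  TwoList-↭ : ∀ {u v : Coord r} {A B} → TwoList u v A → TwoList u v B → A ↭ B
  TwoList-↭ uv uv = ↭-refl
  TwoList-↭ vu vu = ↭-refl
  TwoList-↭ uv vu = ↭-swap _ _ ↭-refl
  TwoList-↭ vu uv = ↭-swap _ _ ↭-refl

  sortTwo : ∀ ψ (u v : Coord r) → ∃[ A ] TwoList u v A × SortedUnder ψ A
  sortTwo ψ u v with LeUnder-total ψ u v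
  ... | inj₁ u≤v = _ , uv , u≤v ∷ [-]
  ... | inj₂ v≤u = _ , vu , v≤u ∷ [-]

  runTwo : ∀ {ψ ψf : Ordering r} {cs} {u v A} → ValidSeq ψ cs ψf → TwoList u v A → SortedUnder ψ A →
           ∃[ B ] TwoList u v B × SortedUnder ψf B × Run ψ cs A B
  runTwo done tA sA = _ , tA , sA , done
  runTwo {u = u} {v} (step {ψ' = ψ′} st vs) tA sA
    with A′ , tA′ , sA′    ← sortTwo ψ′ u v
    with B  , tB  , sB , run ← runTwo vs tA′ sA′
    = B , tB , sB , step st (TwoList-↭ tA′ tA) sA′ run

  bump : Fin r → Coord r
  bump x z = if does (z ≟ x) then 2 else 1

  bump-≢ : ∀ {x z : Fin r} → z ≢ x → bump x z ≡ 1
  bump-≢ {x} {z} z≢x with z ≟ x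
  ... | yes z≡x = ⊥-elim (z≢x z≡x)
  ... | no _    = refl

  bump-self : ∀ (x : Fin r) → bump x x ≡ 2
  bump-self x with x ≟ x
  ... | yes _  = refl
  ... | no x≢x = ⊥-elim (x≢x refl)

  bump-agree : ∀ {x y z : Fin r} → z ≢ x → z ≢ y → bump x z ≡ bump y z
  bump-agree z≢x z≢y = trans (bump-≢ z≢x) (sym (bump-≢ z≢y))

  bump-< : ∀ {x y : Fin r} → x ≢ y → bump y x < bump x x
  bump-< {x} {y} x≢y rewrite bump-≢ x≢y | bump-self x = ℕ.≤-refl

  bump-inBounds : ∀ (x : Fin r) → InBounds (λ _ → 2) (bump x)
  bump-inBounds x z with z ≟ x
  ... | yes _ = s≤s z≤n , ℕ.≤-refl
  ... | no _  = ℕ.≤-refl , s≤s z≤n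

  module _ {σ : Ordering r} {cs} (T : Transforms r σ cs) where

    Transforms⇒¬Before-flipped : ∀ {ψf} {x y : Fin r} → ValidSeq (allFin r) cs ψf → x ≢ y →
                                 Before x y σ → ¬ Before y x ψf
    Transforms⇒¬Before-flipped {ψf} {x} {y} vs x≢y xσy yψx
      with A , tA , sA       ← sortTwo (allFin r) (bump x) (bump y)
      with B , tB , sB , run ← runTwo vs tA sA
      = sorted-both-ways tB sB (proj₂ T (λ _ → 2) A B (inBounds tA) sA run)
      where
      inBounds : ∀ {A} → TwoList (bump x) (bump y) A → All (InBounds (λ _ → 2)) A
      inBounds uv = bump-inBounds x ∷ bump-inBounds y ∷ []
      inBounds vu = bump-inBounds y ∷ bump-inBounds x ∷ []
      sorted-both-ways : ∀ {B} → TwoList (bump x) (bump y) B → SortedUnder ψf B → SortedUnder σ B → ⊥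
      sorted-both-ways uv _ (x≤y ∷ _) =
        Before⇒¬LeUnder xσy (λ z≢x z≢y → bump-agree z≢y z≢x) (bump-< x≢y) x≤y
      sorted-both-ways vu (y≤x ∷ _) _ =
        Before⇒¬LeUnder yψx (λ z≢y z≢x → bump-agree z≢x z≢y) (bump-< (x≢y ∘ sym)) y≤x

    Transforms⇒Inverted : ∀ {ψf} {x : Fin r} → ValidSeq (allFin r) cs ψf →
                          Inverted σ x → Inverted ψf x
    Transforms⇒Inverted {ψf} {x} vs (y , y<x , xσy) =
      Sum.[ (λ xψy → y , y<x , xψy) , (λ yψx → ⊥-elim (Transforms⇒¬Before-flipped vs x≢y xσy yψx)) ]
        (Before-total (∈ψf x) (∈ψf y) x≢y)
      where
      ∈ψf : ∀ z → z ∈ ψf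
      ∈ψf z = ∈-resp-↭ (↭-sym (ValidSeq-↭ vs)) (∈-allFin z)
      x≢y : x ≢ y
      x≢y refl = ℕ.<-irrefl refl y<x

    Transforms⇒#inverted≤length : #inverted σ ≤ length cs
    Transforms⇒#inverted≤length with ψf , vs ← proj₁ T = begin
      #inverted σ                      ≤⟨ count-mono (inverted? σ) (inverted? ψf)
                                                     (Transforms⇒Inverted vs) (allFin r) ⟩
      #inverted ψf                     ≤⟨ #inverted-ValidSeq vs ⟩
      length cs + #inverted (allFin r) ≡⟨ cong (length cs +_) #inverted-allFin ⟩
      length cs + 0                    ≡⟨ ℕ.+-identityʳ (length cs) ⟩
      length cs                        ∎
      where open ℕ.≤-Reasoning

  hoistAll : ∀ pre ys X τ w → Ascending τ → τ ↭ ys ++ w →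
             ∃[ τ′ ] Ascending τ′ × τ′ ↭ w ×
               ValidSeq (pre ++ X ++ τ) (map (pre ,_) ys) (pre ++ reverse ys ++ X ++ τ′)
  hoistAll pre []       X τ w asc τ↭ = τ , asc , τ↭ , done
  hoistAll pre (y ∷ ys) X τ w asc τ↭
    with m , z , refl ← ∈-∃++ (∈-resp-↭ (↭-sym τ↭) (here refl))
    with τ′ , asc′ , τ′↭ , vs ← hoistAll pre ys (y ∷ X) (m ++ z) w (AllPairs-delete m asc)
                                   (drop-∷ (↭-trans (↭-sym (shift y m z)) τ↭))
    = τ′ , asc′ , τ′↭ , step hoist-y (subst (ValidSeq _ _) (cong (pre ++_) reassoc) vs)
    where
    hoist-y : Step (pre ++ X ++ m ++ y ∷ z) (pre , y) (pre ++ y ∷ X ++ m ++ z)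
    hoist-y = subst₂ (λ ψ ψ′ → Step ψ (pre , y) ψ′)
                (cong (pre ++_) (++-assoc X m (y ∷ z))) (cong (λ t → pre ++ y ∷ t) (++-assoc X m z))
                (Step-hoist pre (X ++ m) y z)
    reassoc : reverse ys ++ y ∷ X ++ τ′ ≡ reverse (y ∷ ys) ++ X ++ τ′
    reassoc = sym (trans (cong (_++ X ++ τ′) (unfold-reverse y ys))
                         (++-assoc (reverse ys) [ y ] (X ++ τ′)))

  module _ {σ : Ordering r} (σ-unique : Unique σ) where

    notSubsetTest≡true⇒Inverted : ∀ {x : Fin r} → notSubsetTest r σ x ≡ true → Inverted σ x
    notSubsetTest≡true⇒Inverted {x} t
      with y , y∈ , y∉ ← find (Allₚ.¬All⇒Any¬ (_∈? after x (allFin r)) (after x σ)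
                                 (not-does≡true⇒¬ {after x σ ⊆ after x (allFin r)} (_ ⊆? _) t
                                   ∘ All.lookup))
      with Fin.<-cmp y x
    ... | tri< y<x _ _  = y , y<x , ∈-after⇒Before σ-unique y∈
    ... | tri≈ _ refl _ = ⊥-elim (Before-irrefl σ-unique (∈-after⇒Before σ-unique y∈))
    ... | tri> _ _ x<y  =
      ⊥-elim (y∉ (Ascending-<⇒∈-after Ascending-allFin (∈-allFin x) (∈-allFin y) x<y))

    notSubsetTest≡false⇒< : ∀ {x y : Fin r} → notSubsetTest r σ x ≡ false → y ∈ after x σ →
                            x Fin.< y
    notSubsetTest≡false⇒< {x} t y∈ =
      Ascending-∈-after⇒< Ascending-allFin
        (not-does≡false⇒ {after x σ ⊆ after x (allFin r)} (_ ⊆? _) t y∈)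

    -- One iteration of the outer loop: its calls hoist the scanned modes, last to first.
    record Block (rest : Ordering r) : Set where
      constructor block
      field
        scanned          : Ordering r
        last             : Fin r
        remaining        : Ordering r
        rest≡            : rest ≡ scanned ++ last ∷ remaining
        length-scanned   : length scanned ≡ scanLen r σ rest
        scanned-inverted : All (Inverted σ) scanned
        last<remaining   : All (last Fin.<_) remaining

    private
      scanLen-true : ∀ {x y ys} → notSubsetTest r σ x ≡ true →
                     scanLen r σ (x ∷ y ∷ ys) ≡ suc (scanLen r σ (y ∷ ys))
      scanLen-true t rewrite t = refl

      scanLen-false : ∀ {x y ys} → notSubsetTest r σ x ≡ false → scanLen r σ (x ∷ y ∷ ys) ≡ 0
      scanLen-false t rewrite t = refl

    block-∷ : ∀ pre x xs → pre ++ x ∷ xs ≡ σ → Block (x ∷ xs)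
    block-∷ pre x []       _ = block [] x [] refl refl [] []
    block-∷ pre x (y ∷ ys) e with notSubsetTest r σ x in t
    ... | false =
      block [] x (y ∷ ys) refl (sym (scanLen-false {ys = ys} t)) []
        (All.tabulate (notSubsetTest≡false⇒< t ∘ subst (_ ∈_) after-x))
      where
      after-x : y ∷ ys ≡ after x σ
      after-x = trans (sym (after-++-∷ pre (y ∷ ys) (Unique-middle-∉ pre (subst Unique (sym e) σ-unique))))
                      (cong (after x) e)
    ... | true
      with block ms g rest′ split len inv g< ← block-∷ (pre ++ [ x ]) y ys
                                                 (trans (++-assoc pre [ x ] (y ∷ ys)) e)
      = block (x ∷ ms) g rest′ (cong (x ∷_) split) (trans (cong suc len) (sym (scanLen-true {ys = ys} t)))
          (notSubsetTest≡true⇒Inverted t ∷ inv) g<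

    quesadillaLoop-block : ∀ fuel pre x xs (b : Block (x ∷ xs)) → let open Block b in
      quesadillaLoop r σ (suc fuel) pre (x ∷ xs) ≡
      map (pre ,_) (reverse scanned) ++ quesadillaLoop r σ fuel (pre ++ scanned ++ [ last ]) remaining
    quesadillaLoop-block fuel pre x xs (block ms g rest′ split len _ _) =
      cong₂ _++_ (cong (map (pre ,_) ∘ reverse) take-j)
                 (cong₂ (λ a → quesadillaLoop r σ fuel (pre ++ a)) take-suc-j drop-suc-j)
      where
      take-j : take (scanLen r σ (x ∷ xs)) (x ∷ xs) ≡ ms
      take-j = trans (cong₂ take (sym len) split) (take-length-++ ms (g ∷ rest′))
      take-suc-j : take (suc (scanLen r σ (x ∷ xs))) (x ∷ xs) ≡ ms ++ [ g ]
      take-suc-j = trans (cong₂ (take ∘ suc) (sym len) split) (take-suc-length-++ ms g rest′)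
      drop-suc-j : drop (suc (scanLen r σ (x ∷ xs))) (x ∷ xs) ≡ rest′
      drop-suc-j = trans (cong₂ (drop ∘ suc) (sym len) split) (drop-suc-length-++ ms g rest′)

    length-quesadillaLoop : ∀ fuel pre rest → pre ++ rest ≡ σ →
                            length (quesadillaLoop r σ fuel pre rest) ≤ count (inverted? σ) rest
    length-quesadillaLoop zero       pre rest     _ = z≤n
    length-quesadillaLoop (suc fuel) pre []       _ = z≤n
    length-quesadillaLoop (suc fuel) pre (x ∷ xs) e
      with b@(block ms g rest′ split _ inv _) ← block-∷ pre x xs e = begin
      length (quesadillaLoop r σ (suc fuel) pre (x ∷ xs))
        ≡⟨ cong length (quesadillaLoop-block fuel pre x xs b) ⟩
      length (map (pre ,_) (reverse ms) ++ loop)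
        ≡⟨ length-++ (map (pre ,_) (reverse ms)) ⟩
      length (map (pre ,_) (reverse ms)) + length loop
        ≡⟨ cong (_+ length loop) (trans (length-map (pre ,_) (reverse ms)) (length-reverse ms)) ⟩
      length ms + length loop
        ≤⟨ ℕ.+-mono-≤ (ℕ.≤-reflexive (sym (count-all (inverted? σ) inv)))
                      (length-quesadillaLoop fuel _ rest′
                        (trans (++-∷ʳ-assoc pre ms g rest′) (trans (cong (pre ++_) (sym split)) e))) ⟩
      count (inverted? σ) ms + count (inverted? σ) rest′
        ≤⟨ ℕ.+-monoʳ-≤ (count (inverted? σ) ms) (count-∷ (inverted? σ) g rest′) ⟩
      count (inverted? σ) ms + count (inverted? σ) (g ∷ rest′)
        ≡⟨ count-++ (inverted? σ) ms (g ∷ rest′) ⟨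
      count (inverted? σ) (ms ++ g ∷ rest′)
        ≡⟨ cong (count (inverted? σ)) split ⟨
      count (inverted? σ) (x ∷ xs) ∎
      where
      open ℕ.≤-Reasoning
      loop = quesadillaLoop r σ fuel (pre ++ ms ++ [ g ]) rest′

    quesadillaLoop-valid : ∀ fuel pre rest τ → length rest ≤ fuel → pre ++ rest ≡ σ →
                           Ascending τ → τ ↭ rest →
                           ValidSeq (pre ++ τ) (quesadillaLoop r σ fuel pre rest) σ
    quesadillaLoop-valid zero       pre [] τ _ e _ τ↭
      with refl ← ↭-empty-inv τ↭ = subst (ValidSeq (pre ++ []) []) e done
    quesadillaLoop-valid (suc fuel) pre [] τ _ e _ τ↭
      with refl ← ↭-empty-inv τ↭ = subst (ValidSeq (pre ++ []) []) e done
    quesadillaLoop-valid (suc fuel) pre (x ∷ xs) τ (s≤s len≤) e asc τ↭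
      with b@(block ms g rest′ split _ _ g<) ← block-∷ pre x xs e
      with τ″ , asc″ , τ″↭ , hoisted ← hoistAll pre (reverse ms) [] τ (g ∷ rest′) asc
             (↭-trans τ↭ (subst (_↭ reverse ms ++ g ∷ rest′) (sym split)
                           (++⁺ʳ (g ∷ rest′) (↭-sym (↭-reverse ms)))))
      -- the last mode of the block is the least remaining one, so it is already in place
      with τ′ , refl ← Ascending-↭-head asc″ τ″↭ g<
      = subst (λ cs → ValidSeq (pre ++ τ) cs σ) (sym (quesadillaLoop-block fuel pre x xs b))
          (ValidSeq-++ (subst (ValidSeq (pre ++ τ) _) reassoc hoisted)
            (quesadillaLoop-valid fuel (pre ++ ms ++ [ g ]) rest′ τ′ len′
              (trans (++-∷ʳ-assoc pre ms g rest′) (trans (cong (pre ++_) (sym split)) e))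
              (AllPairs.tail asc″) (drop-∷ τ″↭)))
      where
      reassoc : pre ++ reverse (reverse ms) ++ g ∷ τ′ ≡ (pre ++ ms ++ [ g ]) ++ τ′
      reassoc = trans (cong (λ t → pre ++ t ++ g ∷ τ′) (reverse-involutive ms))
                      (sym (++-∷ʳ-assoc pre ms g τ′))
      len′ : length rest′ ≤ fuel
      len′ = ℕ.≤-trans (ℕ.≤-pred (ℕ.≤-trans (ℕ.m≤n+m (suc (length rest′)) (length ms))
               (ℕ.≤-reflexive (trans (sym (length-++ ms)) (cong length (sym split)))))) len≤

    quesadillaCalls-valid : σ ↭ allFin r → ValidSeq (allFin r) (quesadillaCalls r σ) σ
    quesadillaCalls-valid σ↭ =
      quesadillaLoop-valid r [] σ (allFin r) (ℕ.≤-reflexive (trans (↭-length σ↭) (length-tabulate id)))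
        refl Ascending-allFin (↭-sym σ↭)

    length-quesadillaCalls : σ ↭ allFin r → length (quesadillaCalls r σ) ≤ #inverted σ
    length-quesadillaCalls σ↭ =
      ℕ.≤-trans (length-quesadillaLoop r [] σ refl) (ℕ.≤-reflexive (count-↭ (inverted? σ) σ↭))

theorem3p5 : ∀ (r : ℕ) (σ : Ordering r) → IsCompleteOrdering r σ →
    Transforms r σ (quesadillaCalls r σ) ×
    (∀ (cs : List (Call r)) → Transforms r σ cs →
      length (quesadillaCalls r σ) ≤ length cs)
theorem3p5 r σ σ↭ =
  ((σ , valid) , λ _ _ _ _ sA run → ValidSeq-Run-sorted (allFin⁺ r) valid sA run) ,
  λ cs T → ℕ.≤-trans (length-quesadillaCalls σ-unique σ↭) (Transforms⇒#inverted≤length T)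
  where
  σ-unique : Unique σ
  σ-unique = Unique-resp-↭ (↭-sym σ↭) (allFin⁺ r)
  valid : ValidSeq (allFin r) (quesadillaCalls r σ) σ
  valid = quesadillaCalls-valid σ-unique σ↭
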